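{- Let $n\ge1$, let $f_{n,i}$ be the coefficient of $x^i$ in $(1+x+x^2)^n$, and consider the linear program: minimize $3\sum_{i=0}^{2n} f_{n,i}t_i$ over real $(t_0,\dots,t_{2n})$ subject to $t_i\ge 0$ for all $i$ and $t_i+t_j+t_k\ge 1$ for all $i,j,k\in\{0,\dots,2n\}$ (not necessarily distinct) with $i+j+k\le 2n$. If $(t_0,\dots,t_{2n})$ is a feasible solution, then there is a feasible solution $(t'_0,\dots,t'_{2n})$ with $t'_{2n}=0$ whose objective value is at most that of $(t_i)$, and strictly smaller if $t_{2n}>0$. -}

module Defs where

open import Level using (Level; _⊔_; suc)
open import Algebra.Bundles using (CommutativeRing)
open import Relation.Binary.Core using (Rel)
open import Relation.Binary.Structures using (IsTotalOrder)
open import Relation.Nullary using (¬_)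
open import Data.Product using (Σ; _×_)
open import Data.Nat as ℕ using (ℕ; zero)
open import Data.List using (List; []; _∷_)
open import Data.Fin using (Fin; toℕ; fromℕ)
import Algebra.Definitions.RawMonoid as RM

-- Ordered fields (the reals are one).  Standard axioms: a commutative
-- ring that is a field (nontrivial, nonzero elements invertible), with a
-- total order compatible with + and *.

record OrderedField (c ℓ₁ ℓ₂ : Level) : Set (Level.suc (c ⊔ ℓ₁ ⊔ ℓ₂)) where
  field
    commutativeRing : CommutativeRing c ℓ₁
  open CommutativeRing commutativeRing public
  field
    _≤_            : Rel Carrier ℓ₂
    isTotalOrder   : IsTotalOrder _≈_ _≤_
    1≉0            : ¬ (1# ≈ 0#)
    inverse        : ∀ x → ¬ (x ≈ 0#) → Σ Carrier (λ y → (x * y) ≈ 1#)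
    +-mono-≤       : ∀ {x y} z → x ≤ y → (x + z) ≤ (y + z)
    *-nonneg       : ∀ {x y} → 0# ≤ x → 0# ≤ y → 0# ≤ (x * y)

  _<_ : Rel Carrier (ℓ₁ ⊔ ℓ₂)
  x < y = (x ≤ y) × (¬ (x ≈ y))

  open RM +-rawMonoid public using (sum) renaming (_×_ to _·ℕ_)

-- Coefficients of (1 + x + x²)^n, as lists of naturals (lowest degree first).

addL : List ℕ → List ℕ → List ℕ
addL []       ys       = ys
addL (x ∷ xs) []       = x ∷ xs
addL (x ∷ xs) (y ∷ ys) = (x ℕ.+ y) ∷ addL xs ys

mulTri : List ℕ → List ℕ
mulTri p = addL p (addL (0 ∷ p) (0 ∷ 0 ∷ p))

triPow : ℕ → List ℕ
triPow zero    = 1 ∷ []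
triPow (ℕ.suc n) = mulTri (triPow n)

coeffAt : List ℕ → ℕ → ℕ
coeffAt []       _         = 0
coeffAt (a ∷ _)  zero      = a
coeffAt (_ ∷ as) (ℕ.suc i) = coeffAt as i

f : ℕ → ℕ → ℕ
f n i = coeffAt (triPow n) i

module LP {c ℓ₁ ℓ₂} (F : OrderedField c ℓ₁ ℓ₂) (n : ℕ) where
  open OrderedField F

  Idx : Set
  Idx = Fin (ℕ.suc (2 ℕ.* n))

  top : Idx
  top = fromℕ (2 ℕ.* n)

  Feasible : (Idx → Carrier) → Set (ℓ₂)
  Feasible t = ((i : Idx) → 0# ≤ t i)
             × ((i j k : Idx) → toℕ i ℕ.+ toℕ j ℕ.+ toℕ k ℕ.≤ 2 ℕ.* n → 1# ≤ ((t i + t j) + t k))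

  objective : (Idx → Carrier) → Carrier
  objective t = 3 ·ℕ sum (λ i → f n (toℕ i) ·ℕ t i)

module Submission where

open import Defs
open import Level using (Level)
open import Data.Nat using (ℕ; zero; suc)
import Data.Nat as ℕ
open import Data.Product using (Σ; _×_; _,_; proj₁; proj₂)
import Data.Nat.Properties as ℕP
open import Data.Fin using (Fin; toℕ; fromℕ; inject₁; _≟_) renaming (zero to fz; suc to fs)
open import Data.Fin.Properties using (toℕ-fromℕ; toℕ-injective; fromℕ≢inject₁; suc-injective)
open import Data.List using ([]; _∷_)
open import Data.Sum using (inj₁; inj₂)
open import Data.Empty using (⊥-elim)
open import Relation.Nullary using (¬_; yes; no)
open import Relation.Binary.PropositionalEquality as ≡ using (_≡_; _≢_)
open import Relation.Binary.Structures using (IsTotalOrder)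
open import Algebra.Bundles using (CommutativeMonoid)
import Algebra.Properties.CommutativeSemigroup as CommutativeSemigroupProperties
import Algebra.Properties.Monoid.Sum as MonoidSum
import Algebra.Properties.Monoid.Mult as MonoidMult
import Algebra.Properties.CommutativeMonoid.Mult as CommutativeMonoidMult
import Algebra.Properties.Group as GroupProperties
import Algebra.Properties.Ring as RingProperties
import Relation.Binary.Reasoning.Setoid as SetoidReasoning

-- Move half of t_{2n} onto t_0 and set t_{2n} to 0.  The only constraint
-- involving the index 2n is (2n, 0, 0) up to order, and its value
-- t_{2n} + 2 t_0 is unchanged; every other constraint only gains.  Since
-- f_{n,0} = f_{n,2n} = 1, the objective drops by 3 t_{2n} / 2.

coeffAt-addL : ∀ p q i → coeffAt (addL p q) i ≡ coeffAt p i ℕ.+ coeffAt q i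
coeffAt-addL []       q        i       = ≡.refl
coeffAt-addL (a ∷ p)  []       i       = ≡.sym (ℕP.+-identityʳ _)
coeffAt-addL (a ∷ p)  (b ∷ q)  zero    = ≡.refl
coeffAt-addL (a ∷ p)  (b ∷ q)  (suc i) = coeffAt-addL p q i

coeffAt-mulTri : ∀ p i →
  coeffAt (mulTri p) i ≡ coeffAt p i ℕ.+ (coeffAt (0 ∷ p) i ℕ.+ coeffAt (0 ∷ 0 ∷ p) i)
coeffAt-mulTri p i =
  ≡.trans (coeffAt-addL p _ i) (≡.cong (coeffAt p i ℕ.+_) (coeffAt-addL (0 ∷ p) (0 ∷ 0 ∷ p) i))

f-zero : ∀ n → f n 0 ≡ 1
f-zero zero    = ≡.refl
f-zero (suc n) rewrite coeffAt-mulTri (triPow n) 0 | f-zero n = ≡.refl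

f-vanishes : ∀ n i → 2 ℕ.* n ℕ.< i → f n i ≡ 0
f-vanishes zero    (suc i) _  = ≡.refl
f-vanishes (suc n) i       lt rewrite ℕP.*-suc 2 n = go i lt
  where
  go : ∀ i → suc (suc (2 ℕ.* n)) ℕ.< i → f (suc n) i ≡ 0
  go (suc (suc j)) (ℕ.s≤s (ℕ.s≤s lt))
    rewrite coeffAt-mulTri (triPow n) (suc (suc j))
          | f-vanishes n (suc (suc j)) (ℕP.m≤n⇒m≤1+n (ℕP.m≤n⇒m≤1+n lt))
          | f-vanishes n (suc j) (ℕP.m≤n⇒m≤1+n lt)
          | f-vanishes n j lt = ≡.refl

f-top : ∀ n → f n (2 ℕ.* n) ≡ 1
f-top zero    = ≡.refl
f-top (suc n) rewrite ℕP.*-suc 2 n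
                    | coeffAt-mulTri (triPow n) (suc (suc (2 ℕ.* n)))
                    | f-vanishes n (suc (suc (2 ℕ.* n))) (ℕP.m≤n⇒m≤1+n ℕP.≤-refl)
                    | f-vanishes n (suc (2 ℕ.* n)) ℕP.≤-refl
                    | f-top n = ≡.refl

m+n≤m⇒n≡0 : ∀ m {n} → m ℕ.+ n ℕ.≤ m → n ≡ 0
m+n≤m⇒n≡0 m {n} le =
  ℕP.n≤0⇒n≡0 (ℕP.+-cancelˡ-≤ m n 0 (≡.subst (m ℕ.+ n ℕ.≤_) (≡.sym (ℕP.+-identityʳ m)) le))

module CommutativeMonoidSum {a ℓ} (M : CommutativeMonoid a ℓ) where
  open CommutativeMonoid M
  open MonoidSum monoid using (sum; sum-cong-≋; sum-init-last)
  open CommutativeSemigroupProperties commutativeSemigroup using (x∙yz≈xz∙y; xy∙z≈xz∙y)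
  open SetoidReasoning setoid

  sum-cong-interior : ∀ {k} (u v : Fin (suc (suc k)) → Carrier) {d : Carrier} →
    (∀ y → u (fs (inject₁ y)) ≈ v (fs (inject₁ y))) →
    (u fz ∙ u (fromℕ (suc k))) ∙ d ≈ v fz ∙ v (fromℕ (suc k)) →
    sum u ∙ d ≈ sum v
  sum-cong-interior {k} u v {d} interior ends = begin
    sum u ∙ d                  ≈⟨ ∙-congʳ (∙-congˡ (sum-init-last (λ y → u (fs y)))) ⟩
    (u fz ∙ (Iu ∙ uL)) ∙ d     ≈⟨ ∙-congʳ (x∙yz≈xz∙y (u fz) Iu uL) ⟩
    ((u fz ∙ uL) ∙ Iu) ∙ d     ≈⟨ xy∙z≈xz∙y (u fz ∙ uL) Iu d ⟩
    ((u fz ∙ uL) ∙ d) ∙ Iu     ≈⟨ ∙-cong ends (sum-cong-≋ interior) ⟩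
    (v fz ∙ vL) ∙ Iv           ≈⟨ x∙yz≈xz∙y (v fz) Iv vL ⟨
    v fz ∙ (Iv ∙ vL)           ≈⟨ ∙-congˡ (sum-init-last (λ y → v (fs y))) ⟨
    sum v                      ∎
    where
    uL = u (fromℕ (suc k))
    vL = v (fromℕ (suc k))
    Iu = sum (λ y → u (fs (inject₁ y)))
    Iv = sum (λ y → v (fs (inject₁ y)))

module OrderedFieldProperties {c ℓ₁ ℓ₂} (F : OrderedField c ℓ₁ ℓ₂) where
  open OrderedField F
  open IsTotalOrder isTotalOrder public
    using (total; antisym; ≤-respˡ-≈; ≤-respʳ-≈)
    renaming (refl to ≤-refl; trans to ≤-trans)
  open GroupProperties +-group using (⁻¹-involutive; identityʳ-unique)
  open RingProperties ring using (-‿distribˡ-*; -‿distribʳ-*)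
  open SetoidReasoning setoid

  +-mono-≤₂ : ∀ {x y u v} → x ≤ y → u ≤ v → (x + u) ≤ (y + v)
  +-mono-≤₂ {x} {y} {u} {v} x≤y u≤v =
    ≤-trans (+-mono-≤ u x≤y) (≤-respˡ-≈ (+-comm u y) (≤-respʳ-≈ (+-comm v y) (+-mono-≤ y u≤v)))

  x≤x+y : ∀ {x y} → 0# ≤ y → x ≤ (x + y)
  x≤x+y {x} 0≤y = ≤-respˡ-≈ (+-identityʳ x) (+-mono-≤₂ ≤-refl 0≤y)

  x≤0⇒0≤-x : ∀ {x} → x ≤ 0# → 0# ≤ (- x)
  x≤0⇒0≤-x {x} x≤0 =
    ≤-respˡ-≈ (-‿inverseʳ x) (≤-respʳ-≈ (+-identityˡ (- x)) (+-mono-≤ (- x) x≤0))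

  0≤x*x : ∀ x → 0# ≤ (x * x)
  0≤x*x x with total 0# x
  ... | inj₁ 0≤x = *-nonneg 0≤x 0≤x
  ... | inj₂ x≤0 = ≤-respʳ-≈ -x*-x≈x*x (*-nonneg (x≤0⇒0≤-x x≤0) (x≤0⇒0≤-x x≤0))
    where
    -x*-x≈x*x : - x * - x ≈ x * x
    -x*-x≈x*x = begin
      - x * - x     ≈⟨ -‿distribˡ-* x (- x) ⟨
      - (x * - x)   ≈⟨ -‿cong (-‿distribʳ-* x x) ⟨
      - (- (x * x)) ≈⟨ ⁻¹-involutive (x * x) ⟩
      x * x         ∎

  0≤1 : 0# ≤ 1#
  0≤1 = ≤-respʳ-≈ (*-identityˡ 1#) (0≤x*x 1#)

  1+1≉0 : ¬ (1# + 1# ≈ 0#)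
  1+1≉0 2≈0 = 1≉0 (antisym (≤-respʳ-≈ 2≈0 (x≤x+y 0≤1)) 0≤1)

  ½ : Carrier
  ½ = proj₁ (inverse (1# + 1#) 1+1≉0)

  2*½≈1 : (1# + 1#) * ½ ≈ 1#
  2*½≈1 = proj₂ (inverse (1# + 1#) 1+1≉0)

  -- ½ = (2 ½) ½ = 2 ½², a product of non-negatives.
  0≤½ : 0# ≤ ½
  0≤½ = ≤-respʳ-≈ ½≈2*½*½ (*-nonneg (≤-trans 0≤1 (x≤x+y 0≤1)) (0≤x*x ½))
    where
    ½≈2*½*½ : (1# + 1#) * (½ * ½) ≈ ½
    ½≈2*½*½ = begin
      (1# + 1#) * (½ * ½) ≈⟨ *-assoc _ ½ ½ ⟨
      ((1# + 1#) * ½) * ½ ≈⟨ *-congʳ 2*½≈1 ⟩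
      1# * ½              ≈⟨ *-identityˡ ½ ⟩
      ½                   ∎

  half : Carrier → Carrier
  half x = x * ½

  half+half : ∀ x → half x + half x ≈ x
  half+half x = begin
    x * ½ + x * ½             ≈⟨ +-cong (*-identityʳ _) (*-identityʳ _) ⟨
    x * ½ * 1# + x * ½ * 1#   ≈⟨ distribˡ (x * ½) 1# 1# ⟨
    x * ½ * (1# + 1#)         ≈⟨ *-assoc x ½ _ ⟩
    x * (½ * (1# + 1#))       ≈⟨ *-congˡ (trans (*-comm ½ _) 2*½≈1) ⟩
    x * 1#                    ≈⟨ *-identityʳ x ⟩
    x                         ∎

  half-nonneg : ∀ {x} → 0# ≤ x → 0# ≤ half x
  half-nonneg 0≤x = *-nonneg 0≤x 0≤½

  half-pos : ∀ {x} → 0# < x → 0# < half x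
  half-pos {x} (0≤x , 0≉x) = half-nonneg 0≤x , λ 0≈h → 0≉x (begin
    0#                ≈⟨ +-identityʳ 0# ⟨
    0# + 0#           ≈⟨ +-cong 0≈h 0≈h ⟩
    half x + half x   ≈⟨ half+half x ⟩
    x                 ∎)

  ·ℕ-nonneg : ∀ m {x} → 0# ≤ x → 0# ≤ (m ·ℕ x)
  ·ℕ-nonneg zero    0≤x = ≤-refl
  ·ℕ-nonneg (suc m) 0≤x = ≤-trans 0≤x (x≤x+y (·ℕ-nonneg m 0≤x))

  ·ℕ-pos : ∀ m {x} → 0# < x → 0# < (suc m ·ℕ x)
  ·ℕ-pos m {x} (0≤x , 0≉x) = 0≤mx , λ 0≈mx → 0≉x (antisym 0≤x (≤-respʳ-≈ (sym 0≈mx) x≤mx))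
    where
    x≤mx : x ≤ (suc m ·ℕ x)
    x≤mx = x≤x+y (·ℕ-nonneg m 0≤x)
    0≤mx : 0# ≤ (suc m ·ℕ x)
    0≤mx = ≤-trans 0≤x x≤mx

  x<x+y : ∀ {x y} → 0# < y → x < (x + y)
  x<x+y {x} {y} (0≤y , 0≉y) = x≤x+y 0≤y , λ x≈x+y → 0≉y (sym (identityʳ-unique x y (sym x≈x+y)))

  <-respʳ-≈ : ∀ {x y z} → y ≈ z → x < y → x < z
  <-respʳ-≈ y≈z (x≤y , x≉y) = ≤-respʳ-≈ y≈z x≤y , λ x≈z → x≉y (trans x≈z (sym y≈z))

module LPProperties {c ℓ₁ ℓ₂} (F : OrderedField c ℓ₁ ℓ₂) (n : ℕ) where
  open OrderedField F
  open OrderedFieldProperties F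
  open LP F n
  open MonoidMult +-monoid using (×-congˡ; ×-homo-1)
  open CommutativeSemigroupProperties +-commutativeSemigroup using (xy∙z≈yx∙z; xy∙z≈yz∙x)
  module ℕ+ = CommutativeSemigroupProperties ℕP.+-commutativeSemigroup

  Bounded : Idx → Idx → Idx → Set
  Bounded i j l = toℕ i ℕ.+ toℕ j ℕ.+ toℕ l ℕ.≤ 2 ℕ.* n

  Covers : (Idx → Carrier) → Idx → Idx → Idx → Set ℓ₂
  Covers v i j l = 1# ≤ ((v i + v j) + v l)

  Bounded-top⇒zeros : ∀ {j l} → Bounded top j l → j ≡ fz × l ≡ fz
  Bounded-top⇒zeros {j} {l} b =
    toℕ-injective (ℕP.m+n≡0⇒m≡0 (toℕ j) j+l≡0) , toℕ-injective (ℕP.m+n≡0⇒n≡0 (toℕ j) j+l≡0)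
    where
    j+l≡0 : toℕ j ℕ.+ toℕ l ≡ 0
    j+l≡0 = m+n≤m⇒n≡0 (2 ℕ.* n) (≡.subst (ℕ._≤ 2 ℕ.* n)
      (≡.trans (≡.cong (λ m → m ℕ.+ toℕ j ℕ.+ toℕ l) (toℕ-fromℕ _)) (ℕP.+-assoc _ (toℕ j) (toℕ l))) b)

  feasible-by-domination : ∀ {t u} → Feasible t → (∀ i → 0# ≤ u i) →
    (∀ i → i ≢ top → t i ≤ u i) → Covers u top fz fz → Feasible u
  feasible-by-domination {t} {u} (_ , t-covers) u-nonneg t≤u u-covers-top = u-nonneg , covers
    where
    covers-top : ∀ {j l} → Bounded top j l → Covers u top j l
    covers-top b with Bounded-top⇒zeros b
    ... | ≡.refl , ≡.refl = u-covers-top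

    covers : ∀ i j l → Bounded i j l → Covers u i j l
    covers i j l b with i ≟ top | j ≟ top | l ≟ top
    ... | yes ≡.refl | _ | _ = covers-top b
    ... | no _ | yes ≡.refl | _ =
      ≤-respʳ-≈ (xy∙z≈yx∙z (u j) (u i) (u l))
        (covers-top (≡.subst (ℕ._≤ 2 ℕ.* n) (ℕ+.xy∙z≈yx∙z (toℕ i) (toℕ j) (toℕ l)) b))
    ... | no _ | no _ | yes ≡.refl =
      ≤-respʳ-≈ (xy∙z≈yz∙x (u l) (u i) (u j))
        (covers-top (≡.subst (ℕ._≤ 2 ℕ.* n) (≡.sym (ℕ+.xy∙z≈yz∙x (toℕ l) (toℕ i) (toℕ j))) b))
    ... | no i≢top | no j≢top | no l≢top =
      ≤-trans (t-covers i j l b)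
        (+-mono-≤₂ (+-mono-≤₂ (t≤u i i≢top) (t≤u j j≢top)) (t≤u l l≢top))

  weighted : (Idx → Carrier) → Idx → Carrier
  weighted v i = f n (toℕ i) ·ℕ v i

  weighted-zero : ∀ v → weighted v fz ≈ v fz
  weighted-zero v = trans (×-congˡ (f-zero n)) (×-homo-1 (v fz))

  weighted-top : ∀ v → weighted v top ≈ v top
  weighted-top v = trans (×-congˡ (≡.trans (≡.cong (f n) (toℕ-fromℕ _)) (f-top n))) (×-homo-1 (v top))

module TopRemoval {c ℓ₁ ℓ₂} (F : OrderedField c ℓ₁ ℓ₂) (n′ : ℕ) where
  open OrderedField F
  open OrderedFieldProperties F
  open LP F (suc n′)
  open LPProperties F (suc n′)
  open CommutativeMonoidSum +-commutativeMonoid using (sum-cong-interior)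
  open MonoidMult +-monoid using (×-congʳ)
  open CommutativeMonoidMult +-commutativeMonoid using (×-distrib-+)
  open CommutativeSemigroupProperties +-commutativeSemigroup using (interchange)
  open SetoidReasoning setoid

  objective-+ : ∀ (u v : Idx → Carrier) {d} →
    (∀ y → u (fs (inject₁ y)) ≈ v (fs (inject₁ y))) →
    (u fz + u top) + d ≈ v fz + v top →
    objective u + 3 ·ℕ d ≈ objective v
  objective-+ u v {d} interior ends = begin
    objective u + 3 ·ℕ d          ≈⟨ ×-distrib-+ (sum (weighted u)) d 3 ⟨
    3 ·ℕ (sum (weighted u) + d)   ≈⟨ ×-congʳ 3 (sum-cong-interior (weighted u) (weighted v)
                                       (λ y → ×-congʳ (f (suc n′) (toℕ (fs (inject₁ y)))) (interior y)) weighted-ends) ⟩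
    objective v                   ∎
    where
    weighted-ends : (weighted u fz + weighted u top) + d ≈ weighted v fz + weighted v top
    weighted-ends = trans (+-congʳ (+-cong (weighted-zero u) (weighted-top u)))
                      (trans ends (sym (+-cong (weighted-zero v) (weighted-top v))))

  module _ (t : Idx → Carrier) (feasible : Feasible t) where
    h : Carrier
    h = half (t top)

    raised : Idx → Carrier
    raised fz     = t fz + h
    raised (fs i) = t (fs i)

    lowered : Idx → Carrier
    lowered i with i ≟ top
    ... | yes _ = 0#
    ... | no _  = raised i

    lowered-top : lowered top ≈ 0#
    lowered-top with top ≟ top
    ... | yes _       = refl
    ... | no top≢top  = ⊥-elim (top≢top ≡.refl)

    lowered-off-top : ∀ i → i ≢ top → lowered i ≈ raised i
    lowered-off-top i i≢top with i ≟ top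
    ... | yes i≡top = ⊥-elim (i≢top i≡top)
    ... | no _      = refl

    t≤raised : ∀ i → t i ≤ raised i
    t≤raised fz     = x≤x+y (half-nonneg (proj₁ feasible top))
    t≤raised (fs i) = ≤-refl

    lowered-nonneg : ∀ i → 0# ≤ lowered i
    lowered-nonneg i with i ≟ top
    ... | yes _ = ≤-refl
    ... | no _  = ≤-trans (proj₁ feasible i) (t≤raised i)

    lowered-zero : lowered fz ≈ t fz + h
    lowered-zero = lowered-off-top fz λ ()

    lowered-covers-top : Covers lowered top fz fz
    lowered-covers-top = ≤-respʳ-≈ same-value (proj₂ feasible top fz fz top+0+0≤2n)
      where
      top+0+0≤2n : Bounded top fz fz
      top+0+0≤2n = ℕP.≤-reflexive (≡.trans (ℕP.+-identityʳ _) (≡.trans (ℕP.+-identityʳ _) (toℕ-fromℕ _)))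
      same-value : (t top + t fz) + t fz ≈ (lowered top + lowered fz) + lowered fz
      same-value = begin
        (t top + t fz) + t fz              ≈⟨ +-assoc (t top) (t fz) (t fz) ⟩
        t top + (t fz + t fz)              ≈⟨ +-comm (t top) _ ⟩
        (t fz + t fz) + t top              ≈⟨ +-congˡ (half+half (t top)) ⟨
        (t fz + t fz) + (h + h)            ≈⟨ interchange (t fz) h (t fz) h ⟨
        (t fz + h) + (t fz + h)            ≈⟨ +-congʳ (+-identityˡ (t fz + h)) ⟨
        (0# + (t fz + h)) + (t fz + h)     ≈⟨ +-cong (+-cong lowered-top lowered-zero) lowered-zero ⟨
        (lowered top + lowered fz) + lowered fz ∎

    lowered-feasible : Feasible lowered
    lowered-feasible = feasible-by-domination feasible lowered-nonneg
      (λ i i≢top → ≤-respʳ-≈ (sym (lowered-off-top i i≢top)) (t≤raised i)) lowered-covers-top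

    objective-lowered : objective lowered + 3 ·ℕ h ≈ objective t
    objective-lowered = objective-+ lowered t interior ends
      where
      interior : ∀ y → lowered (fs (inject₁ y)) ≈ t (fs (inject₁ y))
      interior y = lowered-off-top (fs (inject₁ y)) (λ eq → fromℕ≢inject₁ (≡.sym (suc-injective eq)))
      ends : (lowered fz + lowered top) + h ≈ t fz + t top
      ends = begin
        (lowered fz + lowered top) + h  ≈⟨ +-congʳ (+-cong lowered-zero lowered-top) ⟩
        ((t fz + h) + 0#) + h           ≈⟨ +-congʳ (+-identityʳ (t fz + h)) ⟩
        (t fz + h) + h                  ≈⟨ +-assoc (t fz) h h ⟩
        t fz + (h + h)                  ≈⟨ +-congˡ (half+half (t top)) ⟩
        t fz + t top                    ∎

proposition4p1 : ∀ {c ℓ₁ ℓ₂ : Level} (F : OrderedField c ℓ₁ ℓ₂) (n : ℕ) → 1 ℕ.≤ n →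
    let open OrderedField F in let open LP F n in
    (t : Idx → Carrier) → Feasible t →
    Σ (Idx → Carrier) (λ t′ → Feasible t′ × (t′ top ≈ 0#)
    × (objective t′ ≤ objective t)
    × (0# < t top → objective t′ < objective t))
proposition4p1 F (suc n′) _ t feasible =
  lowered t feasible , lowered-feasible t feasible , lowered-top t feasible ,
  ≤-respʳ-≈ (objective-lowered t feasible) (x≤x+y (·ℕ-nonneg 3 (half-nonneg (proj₁ feasible top)))) ,
  λ 0<t-top → <-respʳ-≈ (objective-lowered t feasible) (x<x+y (·ℕ-pos 2 (half-pos 0<t-top)))
  where
  open OrderedFieldProperties F
  open LP F (suc n′)
  open TopRemoval F n′
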